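{- Let $\{P_n\}_{n\ge 0}$ be the Pell sequence, defined by $P_0=0$, $P_1=1$ and $P_{n+2}=2P_{n+1}+P_n$ for all $n\ge 0$. If $n$ and $m$ are nonnegative integers such that $$P_n=a\left(\frac{10^m-1}{9}\right)\quad\text{for some } a\in\{1,2,\ldots,9\},$$ then $n\in\{0,1,2,3\}$. -}

module Defs where

open import Data.Nat using (ℕ; zero; suc; _+_; _*_; _∸_; _^_)
open import Data.Nat.DivMod using (_/_)

P : ℕ → ℕ
P zero = 0
P (suc zero) = 1
P (suc (suc n)) = 2 * P (suc n) + P n

-- repunit (10^m - 1)/9 (exact division; 9 ∣ 10^m - 1)
repunit : ℕ → ℕ
repunit m = (10 ^ m ∸ 1) / 9

-- A repdigit with m digits is a * R m, where R m = 1 1…1 is the repunit and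
-- 1 ≤ a ≤ 9.  For m ≤ 1 the repdigit is at most 9, while P n ≥ 12 as soon
-- as n ≥ 4 (the Pell sequence is non-decreasing and P 4 = 12).  For m ≥ 2
-- we argue modulo 440:
--   * the pair (P n mod 440, P (n+1) mod 440) evolves by an explicit map and
--     returns to (0, 1) after 24 steps, so it stays in a list of 24 pairs;
--   * R m mod 440 for m ≥ 2 stays in the list 11, 111, 231;
--   * no residue a * r (a a digit, r one of these) equals a Pell residue.
module Submission where

open import Defs
open import Data.Nat using (ℕ; zero; suc; _+_; _*_; _∸_; _^_; _≤_; z≤n; s≤s; _≟_; _≤?_; NonZero)
open import Data.Nat.Properties using (≤-refl; ≤-trans; m≤m+n; *-comm; *-zeroʳ; *-identityʳ; m+n∸n≡m)
open import Data.Nat.DivMod using (_%_; _/_; %-distribˡ-+; %-distribˡ-*; m%n%n≡m%n; m*n/n≡m)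
open import Data.Nat.Solver using (module +-*-Solver)
open import Data.Product using (_×_; Σ; _,_; proj₁)
open import Data.Product.Properties using (≡-dec)
open import Data.List using (List; iterate; applyUpTo)
open import Data.List.Relation.Unary.All as All using (All; all?)
open import Data.List.Membership.Propositional using (_∈_)
open import Data.List.Membership.Propositional.Properties using (∈-applyUpTo⁺)
import Data.List.Membership.DecPropositional as DecMembership
open import Data.Empty using (⊥-elim)
open import Relation.Nullary using (¬?)
open import Relation.Nullary.Decidable using (from-yes; from-no)
open import Relation.Binary.PropositionalEquality using (_≡_; _≢_; refl; sym; trans; cong; subst; module ≡-Reasoning)

module _ (n : ℕ) .{{_ : NonZero n}} where
  open ≡-Reasoning

  %-absorbʳ-* : ∀ c x → (c * x) % n ≡ (c * (x % n)) % n
  %-absorbʳ-* c x = begin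
    (c * x) % n                  ≡⟨ %-distribˡ-* c x n ⟩
    (c % n * (x % n)) % n        ≡⟨ cong (λ t → (c % n * t) % n) (sym (m%n%n≡m%n x n)) ⟩
    (c % n * (x % n % n)) % n    ≡⟨ sym (%-distribˡ-* c (x % n) n) ⟩
    (c * (x % n)) % n            ∎

  -- The remainder of c * x + y only depends on the remainders of x and y;
  -- this is what lets the recurrences be run on residues.
  %-affine : ∀ c x y → (c * x + y) % n ≡ (c * (x % n) + y % n) % n
  %-affine c x y = begin
    (c * x + y) % n                        ≡⟨ %-distribˡ-+ (c * x) y n ⟩
    ((c * x) % n + y % n) % n              ≡⟨ cong (λ t → (t + y % n) % n) (%-absorbʳ-* c x) ⟩
    ((c * (x % n)) % n + y % n) % n        ≡⟨ cong (λ t → ((c * (x % n)) % n + t) % n) (sym (m%n%n≡m%n y n)) ⟩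
    ((c * (x % n)) % n + y % n % n) % n    ≡⟨ sym (%-distribˡ-+ (c * (x % n)) (y % n) n) ⟩
    (c * (x % n) + y % n) % n              ∎

trajectory-stays : {A : Set} (f : A → A) (s : ℕ → A) (S : List A) →
  (∀ k → s (suc k) ≡ f (s k)) → All (λ x → f x ∈ S) S → s 0 ∈ S →
  ∀ k → s k ∈ S
trajectory-stays f s S step closed start zero = start
trajectory-stays f s S step closed start (suc k) =
  subst (_∈ S) (sym (step k)) (All.lookup closed (trajectory-stays f s S step closed start k))

rep : ℕ → ℕ
rep zero = 0
rep (suc m) = 10 * rep m + 1

9*rep+1≡10^m : ∀ m → 9 * rep m + 1 ≡ 10 ^ m
9*rep+1≡10^m zero = refl
9*rep+1≡10^m (suc m) = trans (nine-times-step (rep m)) (cong (10 *_) (9*rep+1≡10^m m))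
  where
  open +-*-Solver
  nine-times-step : ∀ r → 9 * (10 * r + 1) + 1 ≡ 10 * (9 * r + 1)
  nine-times-step = solve 1 (λ r → con 9 :* (con 10 :* r :+ con 1) :+ con 1 := con 10 :* (con 9 :* r :+ con 1)) refl

repunit≡rep : ∀ m → repunit m ≡ rep m
repunit≡rep m = begin
  (10 ^ m ∸ 1) / 9          ≡⟨ cong (λ t → (t ∸ 1) / 9) (sym (9*rep+1≡10^m m)) ⟩
  (9 * rep m + 1 ∸ 1) / 9   ≡⟨ cong (_/ 9) (m+n∸n≡m (9 * rep m) 1) ⟩
  (9 * rep m) / 9           ≡⟨ cong (_/ 9) (*-comm 9 (rep m)) ⟩
  (rep m * 9) / 9           ≡⟨ m*n/n≡m (rep m) 9 ⟩
  rep m                     ∎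
  where open ≡-Reasoning

P-step-≤ : ∀ n → P (suc n) ≤ P (suc (suc n))
P-step-≤ n = ≤-trans (m≤m+n (P (suc n)) _) (m≤m+n (2 * P (suc n)) (P n))

P-≥12 : ∀ k → 12 ≤ P (4 + k)
P-≥12 zero = ≤-refl
P-≥12 (suc k) = ≤-trans (P-≥12 k) (P-step-≤ (3 + k))

P≤9⇒n≤3 : ∀ n → P n ≤ 9 → n ≤ 3
P≤9⇒n≤3 0 _ = z≤n
P≤9⇒n≤3 1 _ = s≤s z≤n
P≤9⇒n≤3 2 _ = s≤s (s≤s z≤n)
P≤9⇒n≤3 3 _ = s≤s (s≤s (s≤s z≤n))
P≤9⇒n≤3 (suc (suc (suc (suc k)))) P≤9 = ⊥-elim (from-no (12 ≤? 9) (≤-trans (P-≥12 k) P≤9))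

M : ℕ
M = 440

pellPair : ℕ → ℕ × ℕ
pellPair n = (P n % M , P (suc n) % M)

pellStep : ℕ × ℕ → ℕ × ℕ
pellStep (x , y) = (y , (2 * y + x) % M)

pellPair-step : ∀ n → pellPair (suc n) ≡ pellStep (pellPair n)
pellPair-step n = cong (P (suc n) % M ,_) (%-affine M 2 (P (suc n)) (P n))

pellOrbit : List (ℕ × ℕ)
pellOrbit = iterate pellStep (0 , 1) 24

pellPair∈orbit : ∀ n → pellPair n ∈ pellOrbit
pellPair∈orbit = trajectory-stays pellStep pellPair pellOrbit pellPair-step
  (from-yes (all? (λ p → pellStep p ∈? pellOrbit) pellOrbit)) (from-yes ((0 , 1) ∈? pellOrbit))
  where open DecMembership (≡-dec _≟_ _≟_) using (_∈?_)

repResidue : ℕ → ℕ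
repResidue k = rep (2 + k) % M

repStep : ℕ → ℕ
repStep r = (10 * r + 1) % M

repResidue-step : ∀ k → repResidue (suc k) ≡ repStep (repResidue k)
repResidue-step k = %-affine M 10 (rep (2 + k)) 1

repOrbit : List ℕ
repOrbit = iterate repStep 11 3

repResidue∈orbit : ∀ k → repResidue k ∈ repOrbit
repResidue∈orbit = trajectory-stays repStep repResidue repOrbit repResidue-step
  (from-yes (all? (λ r → repStep r ∈? repOrbit) repOrbit)) (from-yes (11 ∈? repOrbit))
  where open DecMembership _≟_ using (_∈?_)

digits : List ℕ
digits = applyUpTo suc 9

residues-disjoint : All (λ p → All (λ a → All (λ r → proj₁ p ≢ (a * r) % M) repOrbit) digits) pellOrbit
residues-disjoint = from-yes
  (all? (λ p → all? (λ a → all? (λ r → ¬? (proj₁ p ≟ (a * r) % M)) repOrbit) digits) pellOrbit)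

-- Hence no Pell number is a repdigit with at least two digits.  As 1 ≤ a we
-- may write a = suc d, and then a ≤ 9 says d < 9, i.e. a ∈ digits.
P≢long-repdigit : ∀ n k a → 1 ≤ a → a ≤ 9 → P n ≢ a * rep (2 + k)
P≢long-repdigit n k (suc d) _ a≤9 Pn≡ =
  All.lookup (All.lookup (All.lookup residues-disjoint (pellPair∈orbit n))
    (∈-applyUpTo⁺ suc a≤9)) (repResidue∈orbit k)
    (trans (cong (_% M) Pn≡) (%-absorbʳ-* M (suc d) (rep (2 + k))))

theorem20 : (n m : ℕ) → (Σ ℕ λ a → (1 ≤ a) × (a ≤ 9) × (P n ≡ a * repunit m)) →
    n ≤ 3
theorem20 n m (a , 1≤a , a≤9 , Pn≡) = by-length m (trans Pn≡ (cong (a *_) (repunit≡rep m)))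
  where
  by-length : ∀ m → P n ≡ a * rep m → n ≤ 3
  by-length 0 Pn≡0 = P≤9⇒n≤3 n (subst (_≤ 9) (sym (trans Pn≡0 (*-zeroʳ a))) z≤n)
  by-length 1 Pn≡a = P≤9⇒n≤3 n (subst (_≤ 9) (sym (trans Pn≡a (*-identityʳ a))) a≤9)
  by-length (suc (suc k)) Pn≡ = ⊥-elim (P≢long-repdigit n k a 1≤a a≤9 Pn≡)
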